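{- Let $q\ge 2$, $M>m\ge 0$, $\ell\le u$ and $n_0\ge \max\{ -\ell/q^m,0\}$ be integers, and let $x\colon\mathbb{N}_0\to\mathbb{C}$ be a sequence for which there are constants $c_{s,k}\in\mathbb{C}$ ($0\le s<q^M$, $\ell\le k\le u$) such that \[x(q^Mn+s)=\sum_{\ell\le k\le u}c_{s,k}\,x(q^mn+k)\qquad\text{for all } n\ge n_0 \text{ and } 0\le s<q^M.\] Set \[\ell'\coloneqq\Big\lfloor\frac{(\ell+1)q^{M-m}-q^M}{q^{M-m}-1}\Big\rfloor\cdot[\ell<0],\qquad u'\coloneqq q^m-1+\Big\lceil\frac{u\,q^{M-m}}{q^{M-m}-1}\Big\rceil\cdot[u>0],\] and $n_1\coloneqq n_0-\lfloor \ell'/q^M\rfloor$. Using the convention $x(n)=0$ for $n<0$, define the vector-valued sequence $v$ as the concatenation of blocks $v_0,\dots,v_{M-1}$, where for $0\le j<m$ \[v_j=\big(x\circ(n\mapsto q^jn),\ x\circ(n\mapsto q^jn+1),\ \dots,\ x\circ(n\mapsto q^jn+q^j-1)\big)^\top,\] and for $m\le j<M$ \[v_j=\big(x\circ(n\mapsto q^jn+\ell'),\ x\circ(n\mapsto q^jn+\ell'+1),\ \dots,\ x\circ(n\mapsto q^jn+q^j-q^m+u')\big)^\top.\] Then $x$ is a component of $v$, and there exist square matrices $A_0,\dots,A_{q-1}$, depending only on $q,M,m,\ell,u$ and the coefficients $(c_{s,k})$ (in particular not on $n_0$), such that $v(qn+r)=A_rv(n)$ for all $0\le r<q$ and all $n\ge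 n_1$. In particular, $x$ is $q$-regular with offset $n_1$.
   Context: $[S]$ denotes the Iverson bracket ($1$ if $S$ is true, $0$ otherwise). A sequence $x\colon\mathbb{N}_0\to\mathbb{C}$ is called $q$-regular with offset $n_1$ if there are $D\in\mathbb{N}$, a sequence $w\colon\mathbb{N}_0\to\mathbb{C}^D$ whose first component is $x$, and matrices $A_0,\dots,A_{q-1}\in\mathbb{C}^{D\times D}$ with $w(qn+r)=A_rw(n)$ for all $0\le r<q$ and $n\ge n_1$ (a $q$-linear representation with offset $n_1$; if $x$ is a component of $w$ but not the first one, a permutation of components yields such a representation). -}

module Defs where

open import Level using (Level)
open import Algebra.Bundles using (CommutativeRing)
open import Data.Nat as ℕ using (ℕ; zero; suc)
open import Data.Integer as ℤ using (ℤ; +_; -[1+_]; 0ℤ; 1ℤ)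
open import Data.Fin using (Fin; toℕ)
open import Data.List using (List; []; _∷_; _++_; length; lookup; map)
open import Data.Product using (Σ; _×_; _,_; proj₁; proj₂; ∃)
open import Relation.Nullary using (Dec; does)
open import Data.Bool using (true; false)

-- floor(a / b) for a positive natural divisor b (junk value 0 for b = 0)
floorDiv : ℤ → ℕ → ℤ
floorDiv a zero    = 0ℤ
floorDiv a (suc k) = a ℤ./ℕ suc k

ceilDiv : ℤ → ℕ → ℤ
ceilDiv a b = ℤ.- floorDiv (ℤ.- a) b

iverson : ∀ {p} {P : Set p} → Dec P → ℤ
iverson d with does d
... | true  = 1ℤ
... | false = 0ℤ

ℓ′ : (q M m : ℕ) (ℓ : ℤ) → ℤ
ℓ′ q M m ℓ =
  floorDiv ((ℓ ℤ.+ 1ℤ) ℤ.* + (q ℕ.^ (M ℕ.∸ m)) ℤ.- + (q ℕ.^ M)) (q ℕ.^ (M ℕ.∸ m) ℕ.∸ 1)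
  ℤ.* iverson (ℓ ℤ.<? 0ℤ)

u′ : (q M m : ℕ) (u : ℤ) → ℤ
u′ q M m u =
  + (q ℕ.^ m) ℤ.- 1ℤ
  ℤ.+ ceilDiv (u ℤ.* + (q ℕ.^ (M ℕ.∸ m))) (q ℕ.^ (M ℕ.∸ m) ℕ.∸ 1)
      ℤ.* iverson (0ℤ ℤ.<? u)

n₁ : (q M m : ℕ) (ℓ : ℤ) (n₀ : ℕ) → ℤ
n₁ q M m ℓ n₀ = + n₀ ℤ.- floorDiv (ℓ′ q M m ℓ) (q ℕ.^ M)

rangeℤ : ℤ → ℕ → List ℤ
rangeℤ a zero    = []
rangeℤ a (suc c) = a ∷ rangeℤ (a ℤ.+ 1ℤ) c

-- A component (a , b) stands for the sequence n ↦ x(a n + b).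
Comp : Set
Comp = ℕ × ℤ

block : (q M m : ℕ) (ℓ u : ℤ) (j : ℕ) → List Comp
block q M m ℓ u j with j ℕ.<? m
... | Relation.Nullary.yes _ = map (λ b → (q ℕ.^ j , b)) (rangeℤ 0ℤ (q ℕ.^ j))
... | Relation.Nullary.no _  =
  -- offsets ℓ', ℓ'+1, ..., q^j - q^m + u'
  map (λ b → (q ℕ.^ j , b))
      (rangeℤ (ℓ′ q M m ℓ)
              (suc ℤ.∣ (+ (q ℕ.^ j) ℤ.- + (q ℕ.^ m) ℤ.+ u′ q M m u) ℤ.- ℓ′ q M m ℓ ∣))

blocksFrom : (q M m : ℕ) (ℓ u : ℤ) (j k : ℕ) → List Comp
blocksFrom q M m ℓ u j zero    = []
blocksFrom q M m ℓ u j (suc k) = block q M m ℓ u j ++ blocksFrom q M m ℓ u (suc j) k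

comps : (q M m : ℕ) (ℓ u : ℤ) → List Comp
comps q M m ℓ u = blocksFrom q M m ℓ u 0 M

dim : (q M m : ℕ) (ℓ u : ℤ) → ℕ
dim q M m ℓ u = length (comps q M m ℓ u)

module _ {a b : Level} (R : CommutativeRing a b) where
  open CommutativeRing R

  ΣF : (n : ℕ) → (Fin n → Carrier) → Carrier
  ΣF zero    f = 0#
  ΣF (suc n) f = f Fin.zero + ΣF n (λ i → f (Fin.suc i))
    where import Data.Fin as Fin

  ext : (ℕ → Carrier) → ℤ → Carrier
  ext x (+ n)    = x n
  ext x -[1+ n ] = 0#

  Vector : ℕ → Set a
  Vector D = Fin D → Carrier

  Matrix : ℕ → Set a
  Matrix D = Fin D → Fin D → Carrier

  _·_ : ∀ {D} → Matrix D → Vector D → Vector D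
  (A · w) i = ΣF _ (λ k → A i k * w k)

  _≋_ : ∀ {D} → Vector D → Vector D → Set b
  w ≋ w′ = ∀ i → w i ≈ w′ i

  vseq : (q M m : ℕ) (ℓ u : ℤ) (x : ℕ → Carrier) → ℕ → Vector (dim q M m ℓ u)
  vseq q M m ℓ u x n i with lookup (comps q M m ℓ u) i
  ... | (α , β) = ext x (+ (α ℕ.* n) ℤ.+ β)

  IsRegularWithOffset : (q : ℕ) (off : ℤ) (x : ℕ → Carrier) → Set (a Level.⊔ b)
  IsRegularWithOffset q off x =
    Σ ℕ λ D →
    Σ (ℕ → Vector (suc D)) λ w →
    Σ (Fin q → Matrix (suc D)) λ A →
      (∀ n → w n Fin.zero ≈ x n) ×
      (∀ (r : Fin q) (n : ℕ) → off ℤ.≤ + n → w (q ℕ.* n ℕ.+ toℕ r) ≋ (A r · w n))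
    where import Data.Fin as Fin

{-# OPTIONS --safe #-}

-- A component of v is a sequence n ↦ x(q^j n + β) with j < M and β in the offset range of
-- block j. At q n + r it becomes n ↦ x(q^(j+1) n + (q^j r + β)). For j + 1 < M this is again a
-- component. For j + 1 = M, write q^j r + β = q^M d + s with 0 ≤ s < q^M and apply the
-- recurrence at n + d: the result is Σ_k c_{s,k} x(q^m n + (q^m d + ℓ + k)), a combination of
-- components of block m. Hence each row of A_r is a unit vector or a c-weighted sum of unit
-- vectors, whatever x and n₀ are. The offset ranges are closed under β ↦ q^j r + β because
-- ℓ′ ≤ 0 and q^m - 1 ≤ u′, and the floor and ceiling in ℓ′ and u′ are exactly what gives
-- ℓ′ ≤ q^m d + ℓ and q^m d + u ≤ u′ in the second case. The recurrence applies at n + d since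
-- d ≥ ⌊ℓ′/q^M⌋, so n + d ≥ n₀ as soon as n ≥ n₁.

module Submission where

open import Defs
open import Level using (Level)
open import Algebra.Bundles using (CommutativeRing)
open import Data.Nat as ℕ using (ℕ; zero; suc)
import Data.Nat.Properties as ℕ
open import Data.Integer as ℤ using (ℤ; +_; 0ℤ)
import Data.Integer.Properties as ℤ
open import Data.Fin using (Fin; toℕ; fromℕ<) renaming (zero to fzero; suc to fsuc)
import Data.Fin.Properties as Fin
open import Data.List using (List; length; lookup)
open import Data.List.Membership.Propositional using (_∈_)
open import Data.List.Membership.Propositional.Properties using (∈-lookup)
open import Data.List.Relation.Unary.Any using (index)
open import Data.List.Relation.Unary.Any.Properties using (lookup-index)
open import Data.Product using (Σ; ∃; ∃₂; _×_; _,_; proj₁; proj₂)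
open import Data.Product.Properties using (≡-dec)
open import Function using (_∘_; id)
open import Function.Bundles using (_⇔_; mk⇔; module Equivalence)
open import Relation.Nullary using (yes; no; contradiction)
open import Relation.Binary.Definitions using (DecidableEquality)
open import Relation.Binary.PropositionalEquality as ≡ using (_≡_; cong)

module Arithmetic where

  open import Data.Integer hiding (suc)
  open import Data.Integer.Properties
  open import Data.Integer.DivMod using (_%ℕ_; [n/ℕd]*d≤n; n<s[n/ℕd]*d; a≡a%ℕn+[a/ℕn]*n)
  open import Data.Integer.Tactic.RingSolver using (solve)
  open import Data.List using (_∷_; [])
  open import Data.List.Relation.Unary.Any using (here; there)
  open import Data.Nat.Tactic.RingSolver using () renaming (solve-∀ to ℕ-solve-∀)
  open import Relation.Nullary using (Dec; ¬_)
  open import Relation.Binary.PropositionalEquality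
  open ≤-Reasoning

  i<1+j⇒i≤j : ∀ {i} j → i < 1ℤ + j → i ≤ j
  i<1+j⇒i≤j {i} j i<1+j = subst (i ≤_) (pred-suc j) (i<j⇒i≤pred[j] i<1+j)

  i-k<1+j⇒i≤j+k : ∀ {i} j {k} → i - k < 1ℤ + j → i ≤ j + k
  i-k<1+j⇒i≤j+k {i} j {k} h = begin
    i           ≡⟨ solve (i ∷ k ∷ []) ⟩
    i - k + k   ≤⟨ +-monoˡ-≤ k (i<1+j⇒i≤j j h) ⟩
    j + k       ∎

  i+suc∣j-i∣≡1+j : ∀ {i j} → i ≤ j → i + + ℕ.suc ∣ j - i ∣ ≡ 1ℤ + j
  i+suc∣j-i∣≡1+j {i} {j} i≤j = begin-equality
    i + (1ℤ + + ∣ j - i ∣)   ≡⟨ cong (λ z → i + (1ℤ + z)) (0≤i⇒+∣i∣≡i (i≤j⇒0≤j-i i≤j)) ⟩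
    i + (1ℤ + (j - i))       ≡⟨ solve (i ∷ j ∷ []) ⟩
    1ℤ + j                   ∎

  floorDiv-*-≤ : ∀ a D .{{_ : ℕ.NonZero D}} → floorDiv a D * + D ≤ a
  floorDiv-*-≤ a (suc k) = [n/ℕd]*d≤n a (suc k)

  <-suc-floorDiv-* : ∀ a D .{{_ : ℕ.NonZero D}} → a < (1ℤ + floorDiv a D) * + D
  <-suc-floorDiv-* a (suc k) = n<s[n/ℕd]*d a (suc k)

  floorDiv-spec : ∀ a D .{{_ : ℕ.NonZero D}} → a ≡ + (a %ℕ D) + floorDiv a D * + D
  floorDiv-spec a (suc k) = a≡a%ℕn+[a/ℕn]*n a (suc k)

  floorDiv-mono-≤ : ∀ D .{{_ : ℕ.NonZero D}} {a b} → a ≤ b → floorDiv a D ≤ floorDiv b D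
  floorDiv-mono-≤ D {a} {b} a≤b = i<1+j⇒i≤j (floorDiv b D) (*-cancelʳ-<-nonNeg (+ D) (begin-strict
    floorDiv a D * + D            ≤⟨ floorDiv-*-≤ a D ⟩
    a                             ≤⟨ a≤b ⟩
    b                             <⟨ <-suc-floorDiv-* b D ⟩
    (1ℤ + floorDiv b D) * + D     ∎))

  floorDiv-nonPos : ∀ D .{{_ : ℕ.NonZero D}} {a} → a ≤ 0ℤ → floorDiv a D ≤ 0ℤ
  floorDiv-nonPos (suc k) = floorDiv-mono-≤ (suc k)

  ceilDiv-nonNeg : ∀ D .{{_ : ℕ.NonZero D}} {a} → 0ℤ ≤ a → 0ℤ ≤ ceilDiv a D
  ceilDiv-nonNeg D 0≤a = neg-mono-≤ (floorDiv-nonPos D (neg-mono-≤ 0≤a))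

  ≤-ceilDiv-* : ∀ a D .{{_ : ℕ.NonZero D}} → a ≤ ceilDiv a D * + D
  ≤-ceilDiv-* a D = begin
    a                                ≡⟨ neg-involutive a ⟨
    - - a                            ≤⟨ neg-mono-≤ (floorDiv-*-≤ (- a) D) ⟩
    - (floorDiv (- a) D * + D)       ≡⟨ neg-distribˡ-* (floorDiv (- a) D) (+ D) ⟩
    ceilDiv a D * + D                ∎

  iverson-elim : ∀ {p} {P : Set p} (C : ℤ → Set) {a} (d : Dec P) →
    (P → C a) → (¬ P → C 0ℤ) → C (a * iverson d)
  iverson-elim C {a} (yes p) onYes onNo = subst C (sym (*-identityʳ a)) (onYes p)
  iverson-elim C {a} (no ¬p) onYes onNo = subst C (sym (*-zeroʳ a)) (onNo ¬p)

  -- In the next four lemmas read G = q^m, 1 + K = q^(M-m), P = q^M, l′ = ℓ′, d = ⌊t/q^M⌋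
  -- for an offset t of block M, and C = ⌈u q^(M-m) / (q^(M-m) - 1)⌉.
  lowerEnd-bound : ∀ {l l′ d G K} → 0ℤ ≤ K →
    l′ * K ≤ (l + 1ℤ) * (1ℤ + K) - G * (1ℤ + K) →
    l′ < (1ℤ + d) * (G * (1ℤ + K)) → l′ ≤ G * d + l
  lowerEnd-bound {l} {l′} {d} {G} {K} 0≤K h₁ h₂ =
    i-k<1+j⇒i≤j+k (G * d) (*-cancelʳ-<-nonNeg (1ℤ + K) {{nonNegative (i≤j⇒i≤k+j 1ℤ 0≤K)}} (begin-strict
      (l′ - l) * (1ℤ + K)                                           ≡⟨ solve (l ∷ l′ ∷ K ∷ []) ⟩
      l′ * K + (l′ - l * (1ℤ + K))                                  ≤⟨ +-monoˡ-≤ _ h₁ ⟩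
      (l + 1ℤ) * (1ℤ + K) - G * (1ℤ + K) + (l′ - l * (1ℤ + K))      ≡⟨ solve (l ∷ l′ ∷ G ∷ K ∷ []) ⟩
      l′ + (1ℤ + K - G * (1ℤ + K))                                  <⟨ +-monoˡ-< _ h₂ ⟩
      (1ℤ + d) * (G * (1ℤ + K)) + (1ℤ + K - G * (1ℤ + K))           ≡⟨ solve (d ∷ G ∷ K ∷ []) ⟩
      (1ℤ + G * d) * (1ℤ + K)                                       ∎))

  lowerEnd-bound-zero : ∀ {l d G P} → 0ℤ ≤ l → 0ℤ ≤ G → 0ℤ ≤ P →
    0ℤ < (1ℤ + d) * P → 0ℤ ≤ G * d + l
  lowerEnd-bound-zero {d = d} {P = P} 0≤l 0≤G 0≤P h =
    +-mono-≤ (*-monoʳ-≤-nonNeg d {{nonNegative 0≤d}} 0≤G) 0≤l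
    where
    0≤d : 0ℤ ≤ d
    0≤d = i<1+j⇒i≤j d (*-cancelʳ-<-nonNeg P {{nonNegative 0≤P}} h)

  upperEnd-bound : ∀ {u d G K C} → 0ℤ ≤ K → u * (1ℤ + K) ≤ C * K →
    d * (G * (1ℤ + K)) < G * (1ℤ + K) + (G - 1ℤ + C - (G - 1ℤ)) →
    G * d + u ≤ G - 1ℤ + C
  upperEnd-bound {u} {d} {G} {K} {C} 0≤K h₁ h₂ = subst (G * d + u ≤_) (+-identityˡ _)
    (i-k<1+j⇒i≤j+k 0ℤ (*-cancelʳ-<-nonNeg (1ℤ + K) {{nonNegative (i≤j⇒i≤k+j 1ℤ 0≤K)}} (begin-strict
      (G * d + u - (G - 1ℤ + C)) * (1ℤ + K)                                    ≡⟨ solve (u ∷ d ∷ G ∷ K ∷ C ∷ []) ⟩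
      u * (1ℤ + K) + (d * (G * (1ℤ + K)) - G * (1ℤ + K) + (1ℤ + K) - C - C * K) ≤⟨ +-monoˡ-≤ _ h₁ ⟩
      C * K + (d * (G * (1ℤ + K)) - G * (1ℤ + K) + (1ℤ + K) - C - C * K)        ≡⟨ solve (d ∷ G ∷ K ∷ C ∷ []) ⟩
      d * (G * (1ℤ + K)) + (1ℤ + K - G * (1ℤ + K) - C)                         <⟨ +-monoˡ-< _ h₂ ⟩
      G * (1ℤ + K) + (G - 1ℤ + C - (G - 1ℤ)) + (1ℤ + K - G * (1ℤ + K) - C)      ≡⟨ solve (G ∷ K ∷ C ∷ []) ⟩
      (1ℤ + 0ℤ) * (1ℤ + K)                                                     ∎)))

  upperEnd-bound-nonPos : ∀ {u d G P} → 1ℤ ≤ G → 0ℤ ≤ P → u ≤ 0ℤ →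
    d * P < P + (G - 1ℤ + 0ℤ - (G - 1ℤ)) → G * d + u ≤ G - 1ℤ + 0ℤ
  upperEnd-bound-nonPos {u} {d} {G} {P} 1≤G 0≤P u≤0 h = begin
    G * d + u       ≤⟨ +-mono-≤ (*-monoˡ-≤-nonNeg G {{nonNegative 0≤G}} d≤0) u≤0 ⟩
    G * 0ℤ + 0ℤ     ≡⟨ solve (G ∷ []) ⟩
    0ℤ              ≤⟨ i≤j⇒0≤j-i 1≤G ⟩
    G - 1ℤ          ≡⟨ +-identityʳ _ ⟨
    G - 1ℤ + 0ℤ     ∎
    where
    0≤G : 0ℤ ≤ G
    0≤G = ≤-trans (+≤+ ℕ.z≤n) 1≤G
    d≤0 : d ≤ 0ℤ
    d≤0 = i<1+j⇒i≤j 0ℤ (*-cancelʳ-<-nonNeg P {{nonNegative 0≤P}} (begin-strict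
      d * P                                 <⟨ h ⟩
      P + (G - 1ℤ + 0ℤ - (G - 1ℤ))          ≡⟨ solve (G ∷ P ∷ []) ⟩
      (1ℤ + 0ℤ) * P                         ∎))

  ∈-rangeℤ⁻ : ∀ {a c t} → t ∈ rangeℤ a c → a ≤ t × t < a + + c
  ∈-rangeℤ⁻ {a} {suc c} (here refl) = ≤-refl , (begin-strict
    a            ≡⟨ +-identityʳ a ⟨
    a + 0ℤ       <⟨ +-monoʳ-< a (+<+ ℕ.z<s) ⟩
    a + + suc c  ∎)
  ∈-rangeℤ⁻ {a} {suc c} (there t∈) with ∈-rangeℤ⁻ t∈
  ... | a+1≤t , t<a+1+c = ≤-trans (i≤i+j a 1ℤ) a+1≤t , subst (_ <_) (+-assoc a 1ℤ (+ c)) t<a+1+c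

  ∈-rangeℤ⁺ : ∀ {a c t} → a ≤ t → t < a + + c → t ∈ rangeℤ a c
  ∈-rangeℤ⁺ {a} {zero} a≤t t<a+0 = contradiction (subst (_ <_) (+-identityʳ a) t<a+0) (≤⇒≯ a≤t)
  ∈-rangeℤ⁺ {a} {suc c} {t} a≤t t<a+1+c with t ≟ a
  ... | yes refl = here refl
  ... | no t≢a   = there (∈-rangeℤ⁺ a+1≤t (subst (t <_) (sym (+-assoc a 1ℤ (+ c))) t<a+1+c))
    where
    a+1≤t : a + 1ℤ ≤ t
    a+1≤t = subst (_≤ t) (+-comm 1ℤ a) (i<j⇒suc[i]≤j (≤∧≢⇒< a≤t (t≢a ∘ sym)))

  digit-≤ : ∀ q a {r} → r ℕ.< q → a ℕ.* r ℕ.+ a ℕ.≤ q ℕ.* a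
  digit-≤ q a {r} r<q =
    ℕ.≤-trans (ℕ.≤-reflexive eq) (ℕ.≤-trans (ℕ.*-monoʳ-≤ a r<q) (ℕ.≤-reflexive (ℕ.*-comm a q)))
    where
    eq : a ℕ.* r ℕ.+ a ≡ a ℕ.* suc r
    eq = trans (ℕ.+-comm (a ℕ.* r) a) (sym (ℕ.*-suc a r))

  digit-index : ∀ q α n r β → + (α ℕ.* (q ℕ.* n ℕ.+ r)) + β ≡ + (q ℕ.* α ℕ.* n) + (+ (α ℕ.* r) + β)
  digit-index q α n r β = begin-equality
    + (α ℕ.* (q ℕ.* n ℕ.+ r)) + β               ≡⟨ cong (λ z → + z + β) (ℕ-regroup q α n r) ⟩
    + (q ℕ.* α ℕ.* n ℕ.+ α ℕ.* r) + β           ≡⟨ cong (_+ β) (pos-+ (q ℕ.* α ℕ.* n) (α ℕ.* r)) ⟩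
    + (q ℕ.* α ℕ.* n) + + (α ℕ.* r) + β       ≡⟨ +-assoc (+ (q ℕ.* α ℕ.* n)) (+ (α ℕ.* r)) β ⟩
    + (q ℕ.* α ℕ.* n) + (+ (α ℕ.* r) + β)     ∎
    where
    ℕ-regroup : ∀ q α n r → α ℕ.* (q ℕ.* n ℕ.+ r) ≡ q ℕ.* α ℕ.* n ℕ.+ α ℕ.* r
    ℕ-regroup = ℕ-solve-∀

module LinearAlgebra {a b} (R : CommutativeRing a b) where

  open import Data.Vec.Functional using (_∷_)
  open CommutativeRing R
  open import Algebra.Properties.Semiring.Sum semiring
  open import Relation.Binary.Reasoning.Setoid setoid

  _⋅_ : ∀ {n} → Vector R n → Vector R n → Carrier
  _⋅_ {n} u w = ΣF R n (λ k → u k * w k)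

  ΣF≡sum : ∀ n (f : Vector R n) → ΣF R n f ≡ sum f
  ΣF≡sum zero    f = ≡.refl
  ΣF≡sum (suc n) f = cong (λ s → f fzero + s) (ΣF≡sum n (λ i → f (fsuc i)))

  ΣF-cong : ∀ n {f g : Vector R n} → (∀ i → f i ≈ g i) → ΣF R n f ≈ ΣF R n g
  ΣF-cong n {f} {g} f≈g = begin
    ΣF R n f  ≡⟨ ΣF≡sum n f ⟩
    sum f     ≈⟨ sum-cong-≋ f≈g ⟩
    sum g     ≡⟨ ΣF≡sum n g ⟨
    ΣF R n g  ∎

  ΣF-comm : ∀ m n (f : Fin m → Fin n → Carrier) →
    ΣF R m (λ i → ΣF R n (f i)) ≈ ΣF R n (λ j → ΣF R m (λ i → f i j))
  ΣF-comm m n f = begin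
    ΣF R m (λ i → ΣF R n (f i))             ≡⟨ ΣF≡sum m _ ⟩
    sum (λ i → ΣF R n (f i))                ≡⟨ sum-cong-≗ (λ i → ΣF≡sum n (f i)) ⟩
    sum (λ i → sum (f i))                   ≈⟨ ∑-comm f ⟩
    sum (λ j → sum (λ i → f i j))           ≡⟨ sum-cong-≗ (λ j → ΣF≡sum m (λ i → f i j)) ⟨
    sum (λ j → ΣF R m (λ i → f i j))        ≡⟨ ΣF≡sum n _ ⟨
    ΣF R n (λ j → ΣF R m (λ i → f i j))     ∎

  *-distribˡ-ΣF : ∀ n x (f : Vector R n) → x * ΣF R n f ≈ ΣF R n (λ i → x * f i)
  *-distribˡ-ΣF n x f = begin
    x * ΣF R n f              ≡⟨ cong (x *_) (ΣF≡sum n f) ⟩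
    x * sum f                 ≈⟨ *-distribˡ-sum x f ⟩
    sum (λ i → x * f i)       ≡⟨ ΣF≡sum n _ ⟨
    ΣF R n (λ i → x * f i)    ∎

  *-distribʳ-ΣF : ∀ n x (f : Vector R n) → ΣF R n f * x ≈ ΣF R n (λ i → f i * x)
  *-distribʳ-ΣF n x f = begin
    ΣF R n f * x              ≡⟨ cong (_* x) (ΣF≡sum n f) ⟩
    sum f * x                 ≈⟨ *-distribʳ-sum x f ⟩
    sum (λ i → f i * x)       ≡⟨ ΣF≡sum n _ ⟨
    ΣF R n (λ i → f i * x)    ∎

  basis : ∀ {n} → Fin n → Vector R n
  basis fzero    fzero    = 1#
  basis fzero    (fsuc _) = 0#
  basis (fsuc _) fzero    = 0#
  basis (fsuc i) (fsuc j) = basis i j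

  basis-⋅ : ∀ {n} (i : Fin n) (w : Vector R n) → basis i ⋅ w ≈ w i
  basis-⋅ {suc n} fzero w = begin
    1# * w fzero + ΣF R n (λ k → 0# * w (fsuc k))   ≈⟨ +-cong (*-identityˡ _) (ΣF-cong n (λ k → zeroˡ _)) ⟩
    w fzero + ΣF R n (λ _ → 0#)                     ≈⟨ +-congˡ (ΣF-zero n) ⟩
    w fzero + 0#                                    ≈⟨ +-identityʳ _ ⟩
    w fzero                                         ∎
    where
    ΣF-zero : ∀ n → ΣF R n (λ _ → 0#) ≈ 0#
    ΣF-zero n = trans (reflexive (ΣF≡sum n _)) (sum-replicate-zero n)
  basis-⋅ {suc n} (fsuc i) w = begin
    0# * w fzero + basis i ⋅ (λ k → w (fsuc k))     ≈⟨ +-cong (zeroˡ _) (basis-⋅ i (λ k → w (fsuc k))) ⟩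
    0# + w (fsuc i)                                 ≈⟨ +-identityˡ _ ⟩
    w (fsuc i)                                      ∎

  isRegular-fromComponent : ∀ {q D} {off : ℤ} {x : ℕ → Carrier}
    (v : ℕ → Vector R D) (A : Fin q → Matrix R D) (i₀ : Fin D) →
    (∀ n → v n i₀ ≈ x n) →
    (∀ (r : Fin q) (n : ℕ) → off ℤ.≤ + n → _≋_ R (v (q ℕ.* n ℕ.+ toℕ r)) (_·_ R (A r) (v n))) →
    IsRegularWithOffset R q off x
  isRegular-fromComponent {q} {D} {off} {x} v A i₀ v-i₀ rep = D , w , B , (λ n → refl) , step
    where
    w : ℕ → Vector R (suc D)
    w n = x n ∷ v n
    B : Fin q → Matrix R (suc D)
    B r = (0# ∷ A r i₀) ∷ (λ i → 0# ∷ A r i)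
    ignoreFirst : ∀ n (z : Carrier) → z ≈ 0# * x n + z
    ignoreFirst n z = sym (trans (+-congʳ (zeroˡ (x n))) (+-identityˡ z))
    step : ∀ (r : Fin q) (n : ℕ) → off ℤ.≤ + n → _≋_ R (w (q ℕ.* n ℕ.+ toℕ r)) (_·_ R (B r) (w n))
    step r n n≥off fzero    = trans (sym (v-i₀ _)) (trans (rep r n n≥off i₀) (ignoreFirst n _))
    step r n n≥off (fsuc i) = trans (rep r n n≥off i) (ignoreFirst n _)

_≟ᶜ_ : DecidableEquality Comp
_≟ᶜ_ = ≡-dec ℕ._≟_ ℤ._≟_

open import Data.List.Membership.DecPropositional _≟ᶜ_ using (_∈?_)

module Components {a b} (R : CommutativeRing a b) (cs : List Comp) where

  open Arithmetic using (digit-index)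
  open CommutativeRing R
  open LinearAlgebra R
  open import Relation.Binary.Reasoning.Setoid setoid

  evalComp : (ℕ → Carrier) → Comp → ℕ → Carrier
  evalComp x (α , β) n = ext R x (+ (α ℕ.* n) ℤ.+ β)

  evalComp-digit : ∀ x q α β n r →
    evalComp x (α , β) (q ℕ.* n ℕ.+ r) ≡ evalComp x (q ℕ.* α , + (α ℕ.* r) ℤ.+ β) n
  evalComp-digit x q α β n r = cong (ext R x) (digit-index q α n r β)

  evalComp-identity : ∀ x n → evalComp x (1 , ℤ.0ℤ) n ≡ x n
  evalComp-identity x n = cong (ext R x) (≡.trans (ℤ.+-identityʳ (+ (1 ℕ.* n))) (cong +_ (ℕ.*-identityˡ n)))

  values : (ℕ → Carrier) → ℕ → Vector R (length cs)
  values x n i = evalComp x (lookup cs i) n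

  values-index : ∀ x n {κ} (κ∈cs : κ ∈ cs) → values x n (index κ∈cs) ≡ evalComp x κ n
  values-index x n κ∈cs = cong (λ κ → evalComp x κ n) (≡.sym (lookup-index κ∈cs))

  unitRow : Comp → Vector R (length cs)
  unitRow κ with κ ∈? cs
  ... | yes κ∈cs = basis (index κ∈cs)
  ... | no _     = λ _ → 0#

  unitRow-⋅ : ∀ x n {κ} → κ ∈ cs → unitRow κ ⋅ values x n ≈ evalComp x κ n
  unitRow-⋅ x n {κ} κ∈cs with κ ∈? cs
  ... | yes p   = trans (basis-⋅ (index p) (values x n)) (reflexive (values-index x n p))
  ... | no κ∉cs = contradiction κ∈cs κ∉cs

  combinationRow : ∀ {k} → Vector R k → (Fin k → Comp) → Vector R (length cs)
  combinationRow {k} coef κ j = ΣF R k (λ i → coef i * unitRow (κ i) j)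

  combinationRow-⋅ : ∀ x n {k} (coef : Vector R k) (κ : Fin k → Comp) → (∀ i → κ i ∈ cs) →
    combinationRow coef κ ⋅ values x n ≈ ΣF R k (λ i → coef i * evalComp x (κ i) n)
  combinationRow-⋅ x n {k} coef κ κ∈cs = begin
    ΣF R D (λ j → ΣF R k (λ i → coef i * unitRow (κ i) j) * v j)
      ≈⟨ ΣF-cong D (λ j → *-distribʳ-ΣF k (v j) _) ⟩
    ΣF R D (λ j → ΣF R k (λ i → coef i * unitRow (κ i) j * v j))
      ≈⟨ ΣF-comm k D _ ⟨
    ΣF R k (λ i → ΣF R D (λ j → coef i * unitRow (κ i) j * v j))
      ≈⟨ ΣF-cong k (λ i → trans (ΣF-cong D (λ j → *-assoc _ _ _)) (sym (*-distribˡ-ΣF D (coef i) _))) ⟩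
    ΣF R k (λ i → coef i * (unitRow (κ i) ⋅ v))
      ≈⟨ ΣF-cong k (λ i → *-congˡ (unitRow-⋅ x n (κ∈cs i))) ⟩
    ΣF R k (λ i → coef i * evalComp x (κ i) n) ∎
    where
    D = length cs
    v = values x n

module Offsets (q M m : ℕ) (2≤q : 2 ℕ.≤ q) (m<M : m ℕ.< M) (ℓ u : ℤ) (ℓ≤u : ℓ ℤ.≤ u) where

  open Arithmetic
  open import Data.Integer hiding (suc)
  open import Data.Integer.Properties
  open import Data.Integer.DivMod using (_%ℕ_; n%ℕd<d)
  open import Data.Integer.Tactic.RingSolver using (solve)
  open import Data.List using (_∷_; [])
  open import Data.List.Membership.Propositional.Properties using (∈-map⁺; ∈-map⁻; ∈-++⁺ˡ; ∈-++⁺ʳ; ∈-++⁻)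
  open import Data.Sum using (inj₁; inj₂)
  open import Relation.Binary.PropositionalEquality

  instance
    q≢0 : ℕ.NonZero q
    q≢0 = ℕ.>-nonZero (ℕ.<-≤-trans ℕ.z<s 2≤q)
    qᴹ≢0 : ℕ.NonZero (q ℕ.^ M)
    qᴹ≢0 = ℕ.m^n≢0 q M

  k : ℕ
  k = q ℕ.^ (M ℕ.∸ m) ℕ.∸ 1

  qᴹ⁻ᵐ≡1+k : q ℕ.^ (M ℕ.∸ m) ≡ suc k
  qᴹ⁻ᵐ≡1+k = sym (ℕ.m+[n∸m]≡n {1} (ℕ.m^n>0 q (M ℕ.∸ m)))

  instance
    k≢0 : ℕ.NonZero k
    k≢0 = ℕ.>-nonZero (ℕ.∸-monoˡ-≤ 1 (begin
      2                      ≤⟨ 2≤q ⟩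
      q                      ≡⟨ ℕ.*-identityʳ q ⟨
      q ℕ.^ 1                ≤⟨ ℕ.^-monoʳ-≤ q (ℕ.m<n⇒0<n∸m m<M) ⟩
      q ℕ.^ (M ℕ.∸ m)        ∎))
      where open ℕ.≤-Reasoning

  G P K L U L⁻ C⁺ : ℤ
  G = + (q ℕ.^ m)
  P = + (q ℕ.^ M)
  K = + k
  L = ℓ′ q M m ℓ
  U = u′ q M m u
  L⁻ = floorDiv ((ℓ + 1ℤ) * + (q ℕ.^ (M ℕ.∸ m)) - P) k
  C⁺ = ceilDiv (u * + (q ℕ.^ (M ℕ.∸ m))) k

  Q≡1+K : + (q ℕ.^ (M ℕ.∸ m)) ≡ 1ℤ + K
  Q≡1+K = cong +_ qᴹ⁻ᵐ≡1+k

  P≡G*[1+K] : P ≡ G * (1ℤ + K)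
  P≡G*[1+K] = begin
    + (q ℕ.^ M)                                  ≡⟨ cong (λ e → + (q ℕ.^ e)) (ℕ.m+[n∸m]≡n (ℕ.<⇒≤ m<M)) ⟨
    + (q ℕ.^ (m ℕ.+ (M ℕ.∸ m)))                  ≡⟨ cong +_ (ℕ.^-distribˡ-+-* q m (M ℕ.∸ m)) ⟩
    + (q ℕ.^ m ℕ.* q ℕ.^ (M ℕ.∸ m))              ≡⟨ pos-* (q ℕ.^ m) _ ⟩
    G * + (q ℕ.^ (M ℕ.∸ m))                      ≡⟨ cong (G *_) Q≡1+K ⟩
    G * (1ℤ + K)                                 ∎
    where open ≡-Reasoning

  1≤G : 1ℤ ≤ G
  1≤G = +≤+ (ℕ.m^n>0 q m)

  0≤P : 0ℤ ≤ P
  0≤P = +≤+ ℕ.z≤n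

  L≤0 : L ≤ 0ℤ
  L≤0 = iverson-elim (_≤ 0ℤ) {L⁻} (ℓ <? 0ℤ)
    (λ ℓ<0 → floorDiv-nonPos k (i≤j⇒i-k≤j P ([ℓ+1]Q≤0 ℓ<0)))
    (λ _ → ≤-refl)
    where
    [ℓ+1]Q≤0 : ℓ < 0ℤ → (ℓ + 1ℤ) * + (q ℕ.^ (M ℕ.∸ m)) ≤ 0ℤ
    [ℓ+1]Q≤0 ℓ<0 = *-monoʳ-≤-nonNeg (+ (q ℕ.^ (M ℕ.∸ m))) (subst (_≤ 0ℤ) (+-comm 1ℤ ℓ) (i<j⇒suc[i]≤j ℓ<0))

  L-bound : ∀ d → L < (1ℤ + d) * P → L ≤ G * d + ℓ
  L-bound d = iverson-elim (λ z → z < (1ℤ + d) * P → z ≤ G * d + ℓ) {L⁻} (ℓ <? 0ℤ)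
    (λ _ L⁻<[1+d]P → lowerEnd-bound {ℓ} {L⁻} {d} {G} {K} (+≤+ ℕ.z≤n) floor-bound
                       (subst (λ P′ → L⁻ < (1ℤ + d) * P′) P≡G*[1+K] L⁻<[1+d]P))
    (λ ℓ≮0 → lowerEnd-bound-zero {ℓ} {d} {G} {P} (≮⇒≥ ℓ≮0) (≤-trans (+≤+ ℕ.z≤n) 1≤G) 0≤P)
    where
    floor-bound : L⁻ * K ≤ (ℓ + 1ℤ) * (1ℤ + K) - G * (1ℤ + K)
    floor-bound = subst (L⁻ * K ≤_) (cong₂ (λ Q P′ → (ℓ + 1ℤ) * Q - P′) Q≡1+K P≡G*[1+K])
                    (floorDiv-*-≤ ((ℓ + 1ℤ) * + (q ℕ.^ (M ℕ.∸ m)) - P) k)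

  G-1≤U : G - 1ℤ ≤ U
  G-1≤U = iverson-elim (λ z → G - 1ℤ ≤ G - 1ℤ + z) {C⁺} (0ℤ <? u)
    (λ 0<u → i≤i+j _ _ {{nonNegative (ceilDiv-nonNeg k (*-monoʳ-≤-nonNeg (+ (q ℕ.^ (M ℕ.∸ m))) (<⇒≤ 0<u)))}})
    (λ _ → ≤-reflexive (sym (+-identityʳ _)))

  U-bound : ∀ d → d * P < P + (U - (G - 1ℤ)) → G * d + u ≤ U
  U-bound d = iverson-elim (λ z → d * P < P + (G - 1ℤ + z - (G - 1ℤ)) → G * d + u ≤ G - 1ℤ + z)
    {C⁺} (0ℤ <? u)
    (λ _ dP<P+s → upperEnd-bound {u} {d} {G} {K} {C⁺} (+≤+ ℕ.z≤n) ceil-bound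
                     (subst (λ P′ → d * P′ < P′ + (G - 1ℤ + C⁺ - (G - 1ℤ))) P≡G*[1+K] dP<P+s))
    (λ u≯0 → upperEnd-bound-nonPos {u} {d} {G} {P} 1≤G 0≤P (≮⇒≥ u≯0))
    where
    ceil-bound : u * (1ℤ + K) ≤ C⁺ * K
    ceil-bound = subst (λ Q → u * Q ≤ C⁺ * K) Q≡1+K (≤-ceilDiv-* (u * + (q ℕ.^ (M ℕ.∸ m))) k)

  lower slack : ℕ → ℤ
  lower j with j ℕ.<? m
  ... | yes _ = 0ℤ
  ... | no _  = L
  slack j with j ℕ.<? m
  ... | yes _ = 0ℤ
  ... | no _  = U - (G - 1ℤ)

  InBlock : ℕ → ℤ → Set
  InBlock j β = lower j ≤ β × β < + (q ℕ.^ j) + slack j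

  lower≤0 : ∀ j → lower j ≤ 0ℤ
  lower≤0 j with j ℕ.<? m
  ... | yes _ = ≤-refl
  ... | no _  = L≤0

  0≤slack : ∀ j → 0ℤ ≤ slack j
  0≤slack j with j ℕ.<? m
  ... | yes _ = ≤-refl
  ... | no _  = i≤j⇒0≤j-i G-1≤U

  lower-suc : ∀ j → lower (suc j) ≤ lower j
  lower-suc j with suc j ℕ.<? m | j ℕ.<? m
  ... | yes _    | yes _   = ≤-refl
  ... | no _     | yes _   = L≤0
  ... | no _     | no _    = ≤-refl
  ... | yes 1+j<m | no j≮m = contradiction (ℕ.<-trans (ℕ.n<1+n j) 1+j<m) j≮m

  slack-suc : ∀ j → slack j ≤ slack (suc j)
  slack-suc j with suc j ℕ.<? m | j ℕ.<? m
  ... | yes _    | yes _   = ≤-refl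
  ... | no _     | yes _   = i≤j⇒0≤j-i G-1≤U
  ... | no _     | no _    = ≤-refl
  ... | yes 1+j<m | no j≮m = contradiction (ℕ.<-trans (ℕ.n<1+n j) 1+j<m) j≮m

  InBlock-step : ∀ {j β r} → r ℕ.< q → InBlock j β → InBlock (suc j) (+ (q ℕ.^ j ℕ.* r) + β)
  InBlock-step {j} {β} {r} r<q (lo≤β , β<up) =
    ≤-trans (lower-suc j) (≤-trans lo≤β (i≤j+i β (+ (q ℕ.^ j ℕ.* r)))) , (begin-strict
      + (q ℕ.^ j ℕ.* r) + β                          <⟨ +-monoʳ-< (+ (q ℕ.^ j ℕ.* r)) β<up ⟩
      + (q ℕ.^ j ℕ.* r) + (+ (q ℕ.^ j) + slack j)    ≡⟨ +-assoc (+ (q ℕ.^ j ℕ.* r)) (+ (q ℕ.^ j)) (slack j) ⟨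
      + (q ℕ.^ j ℕ.* r ℕ.+ q ℕ.^ j) + slack j        ≤⟨ +-monoˡ-≤ (slack j) (+≤+ (digit-≤ q (q ℕ.^ j) r<q)) ⟩
      + (q ℕ.^ suc j) + slack j                      ≤⟨ +-monoʳ-≤ (+ (q ℕ.^ suc j)) (slack-suc j) ⟩
      + (q ℕ.^ suc j) + slack (suc j)                ∎)
    where open ≤-Reasoning

  InBlock-origin : InBlock 0 0ℤ
  InBlock-origin = lower≤0 0 , suc[i]≤j⇒i<j (+-monoʳ-≤ 1ℤ (0≤slack 0))

  InBlock-≥m : ∀ {j β} → m ℕ.≤ j → InBlock j β ⇔ (L ≤ β × β < + (q ℕ.^ j) + (U - (G - 1ℤ)))
  InBlock-≥m {j} m≤j with j ℕ.<? m
  ... | yes j<m = contradiction m≤j (ℕ.<⇒≱ j<m)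
  ... | no _    = mk⇔ id id

  block-end : ∀ j → 1ℤ + (+ (q ℕ.^ j) - G + U) ≡ + (q ℕ.^ j) + (U - (G - 1ℤ))
  block-end j = rearrange (+ (q ℕ.^ j)) G U
    where
    rearrange : ∀ a g v → 1ℤ + (a - g + v) ≡ a + (v - (g - 1ℤ))
    rearrange a g v = solve (a ∷ g ∷ v ∷ [])

  L≤block-last : ∀ j → L ≤ + (q ℕ.^ j) - G + U
  L≤block-last j = ≤-trans L≤0 (i<1+j⇒i≤j _ (begin-strict
    0ℤ                                 <⟨ +-mono-<-≤ (+<+ (ℕ.m^n>0 q j)) (i≤j⇒0≤j-i G-1≤U) ⟩
    + (q ℕ.^ j) + (U - (G - 1ℤ))       ≡⟨ block-end j ⟨
    1ℤ + (+ (q ℕ.^ j) - G + U)         ∎))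
    where open ≤-Reasoning

  ∈-block⁺ : ∀ {j β} → InBlock j β → (q ℕ.^ j , β) ∈ block q M m ℓ u j
  ∈-block⁺ {j} {β} β∈ with j ℕ.<? m
  ... | yes _ = ∈-map⁺ (q ℕ.^ j ,_) (∈-rangeℤ⁺ (proj₁ β∈) (subst (β <_) (+-identityʳ _) (proj₂ β∈)))
  ... | no _  = ∈-map⁺ (q ℕ.^ j ,_) (∈-rangeℤ⁺ (proj₁ β∈)
                  (subst (β <_) (trans (sym (block-end j)) (sym (i+suc∣j-i∣≡1+j (L≤block-last j)))) (proj₂ β∈)))

  ∈-block⁻ : ∀ {j κ} → κ ∈ block q M m ℓ u j → ∃ λ β → κ ≡ (q ℕ.^ j , β) × InBlock j β
  ∈-block⁻ {j} κ∈ with j ℕ.<? m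
  ... | yes _ with ∈-map⁻ (q ℕ.^ j ,_) κ∈
  ...   | β , β∈ , refl = β , refl , proj₁ (∈-rangeℤ⁻ β∈) ,
          subst (β <_) (sym (+-identityʳ _)) (proj₂ (∈-rangeℤ⁻ β∈))
  ∈-block⁻ {j} κ∈ | no _ with ∈-map⁻ (q ℕ.^ j ,_) κ∈
  ...   | β , β∈ , refl = β , refl , proj₁ (∈-rangeℤ⁻ β∈) ,
          subst (β <_) (trans (i+suc∣j-i∣≡1+j (L≤block-last j)) (block-end j)) (proj₂ (∈-rangeℤ⁻ β∈))

  ∈-blocksFrom⁺ : ∀ {i j β} n → i ℕ.≤ j → j ℕ.< i ℕ.+ n → InBlock j β →
    (q ℕ.^ j , β) ∈ blocksFrom q M m ℓ u i n
  ∈-blocksFrom⁺ {i} zero i≤j j<i+0 _ = contradiction (subst (_ ℕ.<_) (ℕ.+-identityʳ i) j<i+0) (ℕ.≤⇒≯ i≤j)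
  ∈-blocksFrom⁺ {i} {j} (suc n) i≤j j<i+1+n β∈ with i ℕ.≟ j
  ... | yes refl = ∈-++⁺ˡ (∈-block⁺ β∈)
  ... | no i≢j   = ∈-++⁺ʳ (block q M m ℓ u i)
                     (∈-blocksFrom⁺ n (ℕ.≤∧≢⇒< i≤j i≢j) (subst (j ℕ.<_) (ℕ.+-suc i n) j<i+1+n) β∈)

  ∈-blocksFrom⁻ : ∀ {i κ} n → κ ∈ blocksFrom q M m ℓ u i n →
    ∃₂ λ j β → j ℕ.< i ℕ.+ n × κ ≡ (q ℕ.^ j , β) × InBlock j β
  ∈-blocksFrom⁻ {i} (suc n) κ∈ with ∈-++⁻ (block q M m ℓ u i) κ∈
  ... | inj₁ κ∈block with ∈-block⁻ κ∈block
  ...   | β , κ≡ , β∈ = i , β , ℕ.m<m+n i ℕ.z<s , κ≡ , β∈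
  ∈-blocksFrom⁻ {i} (suc n) κ∈ | inj₂ κ∈rest with ∈-blocksFrom⁻ n κ∈rest
  ...   | j , β , j<1+i+n , κ≡ , β∈ = j , β , subst (j ℕ.<_) (sym (ℕ.+-suc i n)) j<1+i+n , κ≡ , β∈

  ∈-comps⁺ : ∀ {j β} → j ℕ.< M → InBlock j β → (q ℕ.^ j , β) ∈ comps q M m ℓ u
  ∈-comps⁺ = ∈-blocksFrom⁺ M ℕ.z≤n

  ∈-comps⁻ : ∀ {κ} → κ ∈ comps q M m ℓ u → ∃₂ λ j β → j ℕ.< M × κ ≡ (q ℕ.^ j , β) × InBlock j β
  ∈-comps⁻ = ∈-blocksFrom⁻ M

  residue : ℤ → Fin (q ℕ.^ M)
  residue t = fromℕ< (n%ℕd<d t (q ℕ.^ M))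

  quotient : ℤ → ℤ
  quotient t = floorDiv t (q ℕ.^ M)

  ∈-comps-recurrence : ∀ {t} → L ≤ t → t < P + (U - (G - 1ℤ)) → (i : Fin (suc ∣ u - ℓ ∣)) →
    (q ℕ.^ m , G * quotient t + (ℓ + + toℕ i)) ∈ comps q M m ℓ u
  ∈-comps-recurrence {t} L≤t t<end i = ∈-comps⁺ m<M (Equivalence.from (InBlock-≥m ℕ.≤-refl) (lo , hi))
    where
    open ≤-Reasoning
    d = quotient t
    ℓ+i≤u : ℓ + + toℕ i ≤ u
    ℓ+i≤u = begin
      ℓ + + toℕ i          ≤⟨ +-monoʳ-≤ ℓ (+≤+ (ℕ.s≤s⁻¹ (Fin.toℕ<n i))) ⟩
      ℓ + + ∣ u - ℓ ∣      ≡⟨ cong (λ z → ℓ + z) (0≤i⇒+∣i∣≡i (i≤j⇒0≤j-i ℓ≤u)) ⟩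
      ℓ + (u - ℓ)          ≡⟨ solve (ℓ ∷ u ∷ []) ⟩
      u                    ∎
    lo : L ≤ G * d + (ℓ + + toℕ i)
    lo = begin
      L                        ≤⟨ L-bound d (≤-<-trans L≤t (<-suc-floorDiv-* t (q ℕ.^ M))) ⟩
      G * d + ℓ                ≤⟨ +-monoʳ-≤ (G * d) (i≤i+j ℓ (+ toℕ i)) ⟩
      G * d + (ℓ + + toℕ i)    ∎
    hi : G * d + (ℓ + + toℕ i) < G + (U - (G - 1ℤ))
    hi = begin-strict
      G * d + (ℓ + + toℕ i)    ≤⟨ +-monoʳ-≤ (G * d) ℓ+i≤u ⟩
      G * d + u                ≤⟨ U-bound d (≤-<-trans (floorDiv-*-≤ t (q ℕ.^ M)) t<end) ⟩
      U                        <⟨ suc[i]≤j⇒i<j ≤-refl ⟩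
      1ℤ + U                   ≡⟨ rearrange G U ⟩
      G + (U - (G - 1ℤ))       ∎
      where
      rearrange : ∀ g v → 1ℤ + v ≡ g + (v - (g - 1ℤ))
      rearrange g v = solve (g ∷ v ∷ [])

  shift-index : ∀ {n₀ n t} → n₁ q M m ℓ n₀ ≤ + n → L ≤ t →
    Σ ℕ λ N → n₀ ℕ.≤ N
            × + (q ℕ.^ M ℕ.* n) + t ≡ + (q ℕ.^ M ℕ.* N ℕ.+ toℕ (residue t))
            × (∀ e → + (q ℕ.^ m ℕ.* N) + e ≡ + (q ℕ.^ m ℕ.* n) + (G * quotient t + e))
  shift-index {n₀} {n} {t} n₁≤n L≤t = ∣ + n + d ∣ , n₀≤N , split , shift
    where
    d = quotient t
    e₀ = floorDiv L (q ℕ.^ M)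
    n₀≤n+d : + n₀ ≤ + n + d
    n₀≤n+d = begin
      + n₀                 ≡⟨ regroup (+ n₀) e₀ ⟩
      + n₀ - e₀ + e₀       ≤⟨ +-mono-≤ n₁≤n (floorDiv-mono-≤ (q ℕ.^ M) L≤t) ⟩
      + n + d              ∎
      where
      open ≤-Reasoning
      regroup : ∀ a e → a ≡ a - e + e
      regroup a e = solve (a ∷ e ∷ [])
    +N≡n+d : + ∣ + n + d ∣ ≡ + n + d
    +N≡n+d = 0≤i⇒+∣i∣≡i (≤-trans (+≤+ ℕ.z≤n) n₀≤n+d)
    n₀≤N : n₀ ℕ.≤ ∣ + n + d ∣
    n₀≤N = drop‿+≤+ (subst (+ n₀ ≤_) (sym +N≡n+d) n₀≤n+d)
    split : + (q ℕ.^ M ℕ.* n) + t ≡ + (q ℕ.^ M ℕ.* ∣ + n + d ∣ ℕ.+ toℕ (residue t))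
    split = begin
      + (q ℕ.^ M ℕ.* n) + t                        ≡⟨ cong₂ _+_ (pos-* (q ℕ.^ M) n) (floorDiv-spec t (q ℕ.^ M)) ⟩
      P * + n + (+ (t %ℕ q ℕ.^ M) + d * P)         ≡⟨ regroup P (+ n) d (+ (t %ℕ q ℕ.^ M)) ⟩
      P * (+ n + d) + + (t %ℕ q ℕ.^ M)             ≡⟨ cong₂ (λ a b → P * a + + b) (sym +N≡n+d) (sym (Fin.toℕ-fromℕ< _)) ⟩
      P * + ∣ + n + d ∣ + + toℕ (residue t)        ≡⟨ cong (_+ + toℕ (residue t)) (pos-* (q ℕ.^ M) _) ⟨
      + (q ℕ.^ M ℕ.* ∣ + n + d ∣ ℕ.+ toℕ (residue t)) ∎
      where
      open ≡-Reasoning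
      regroup : ∀ p a d s → p * a + (s + d * p) ≡ p * (a + d) + s
      regroup p a d s = solve (p ∷ a ∷ d ∷ s ∷ [])
    shift : ∀ e → + (q ℕ.^ m ℕ.* ∣ + n + d ∣) + e ≡ + (q ℕ.^ m ℕ.* n) + (G * d + e)
    shift e = begin
      + (q ℕ.^ m ℕ.* ∣ + n + d ∣) + e    ≡⟨ cong (_+ e) (trans (pos-* (q ℕ.^ m) _) (cong (G *_) +N≡n+d)) ⟩
      G * (+ n + d) + e                  ≡⟨ regroup G (+ n) d e ⟩
      G * + n + (G * d + e)              ≡⟨ cong (_+ (G * d + e)) (pos-* (q ℕ.^ m) n) ⟨
      + (q ℕ.^ m ℕ.* n) + (G * d + e)    ∎
      where
      open ≡-Reasoning
      regroup : ∀ g a d e → g * (a + d) + e ≡ g * a + (g * d + e)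
      regroup g a d e = solve (g ∷ a ∷ d ∷ e ∷ [])

module Construction {a b} (R : CommutativeRing a b) (q M m : ℕ) (2≤q : 2 ℕ.≤ q) (m<M : m ℕ.< M)
                    (ℓ u : ℤ) (ℓ≤u : ℓ ℤ.≤ u) where

  open CommutativeRing R
  open Offsets q M m 2≤q m<M ℓ u ℓ≤u
  open LinearAlgebra R
  open Components R (comps q M m ℓ u)
  open import Relation.Binary.Reasoning.Setoid setoid

  terms : ℕ
  terms = suc ℤ.∣ u ℤ.- ℓ ∣

  Coefficients : Set a
  Coefficients = Fin (q ℕ.^ M) → Fin terms → Carrier

  recurrenceTerm : ℤ → Fin terms → Comp
  recurrenceTerm t i = q ℕ.^ m , G ℤ.* quotient t ℤ.+ (ℓ ℤ.+ + toℕ i)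

  row : Coefficients → Fin q → Comp → Vector R (dim q M m ℓ u)
  row c r (α , β) with q ℕ.* α ℕ.≟ q ℕ.^ M
  ... | no _  = unitRow (q ℕ.* α , + (α ℕ.* toℕ r) ℤ.+ β)
  ... | yes _ = combinationRow (c (residue t)) (recurrenceTerm t)
    where
    t = + (α ℕ.* toℕ r) ℤ.+ β

  matrices : Coefficients → Fin q → Matrix R (dim q M m ℓ u)
  matrices c r i = row c r (lookup (comps q M m ℓ u) i)

  x-component : ∀ x → Σ (Fin (dim q M m ℓ u)) λ i → ∀ n → vseq R q M m ℓ u x n i ≈ x n
  x-component x = index origin∈ , λ n → reflexive (≡.trans (values-index x n origin∈) (evalComp-identity x n))
    where
    origin∈ : (1 , 0ℤ) ∈ comps q M m ℓ u
    origin∈ = ∈-comps⁺ (ℕ.≤-<-trans ℕ.z≤n m<M) InBlock-origin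

  module Correctness (c : Coefficients) (n₀ : ℕ) (x : ℕ → Carrier)
    (hx : ∀ n → n₀ ℕ.≤ n → (s : Fin (q ℕ.^ M)) →
       x (q ℕ.^ M ℕ.* n ℕ.+ toℕ s) ≈ ΣF R terms (λ i → c s i * ext R x (+ (q ℕ.^ m ℕ.* n) ℤ.+ (ℓ ℤ.+ + toℕ i))))
    where

    recurrence-shifted : ∀ {t n} → n₁ q M m ℓ n₀ ℤ.≤ + n → L ℤ.≤ t →
      ext R x (+ (q ℕ.^ M ℕ.* n) ℤ.+ t) ≈ ΣF R terms (λ i → c (residue t) i * evalComp x (recurrenceTerm t i) n)
    recurrence-shifted {t} {n} n₁≤n L≤t with shift-index n₁≤n L≤t
    ... | N , n₀≤N , split , shift = begin
      ext R x (+ (q ℕ.^ M ℕ.* n) ℤ.+ t)          ≡⟨ cong (ext R x) split ⟩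
      x (q ℕ.^ M ℕ.* N ℕ.+ toℕ (residue t))      ≈⟨ hx N n₀≤N (residue t) ⟩
      ΣF R terms (λ i → c (residue t) i * ext R x (+ (q ℕ.^ m ℕ.* N) ℤ.+ (ℓ ℤ.+ + toℕ i)))
        ≈⟨ ΣF-cong terms (λ i → *-congˡ {c (residue t) i} (reflexive (cong (ext R x) (shift (ℓ ℤ.+ + toℕ i))))) ⟩
      ΣF R terms (λ i → c (residue t) i * evalComp x (recurrenceTerm t i) n) ∎

    row-⋅-next : ∀ {j β n} (r : Fin q) → j ℕ.< M → InBlock (suc j) (+ (q ℕ.^ j ℕ.* toℕ r) ℤ.+ β) →
      n₁ q M m ℓ n₀ ℤ.≤ + n →
      evalComp x (q ℕ.^ suc j , + (q ℕ.^ j ℕ.* toℕ r) ℤ.+ β) n ≈ row c r (q ℕ.^ j , β) ⋅ values x n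
    row-⋅-next {j} {β} {n} r j<M t∈ n₁≤n with q ℕ.* q ℕ.^ j ℕ.≟ q ℕ.^ M
    ... | no qʲ⁺¹≢qᴹ = sym (unitRow-⋅ x n (∈-comps⁺ (ℕ.≤∧≢⇒< j<M (qʲ⁺¹≢qᴹ ∘ cong (q ℕ.^_))) t∈))
    ... | yes qʲ⁺¹≡qᴹ = begin
      ext R x (+ (q ℕ.^ suc j ℕ.* n) ℤ.+ t)      ≡⟨ cong (λ α → ext R x (+ (α ℕ.* n) ℤ.+ t)) qʲ⁺¹≡qᴹ ⟩
      ext R x (+ (q ℕ.^ M ℕ.* n) ℤ.+ t)          ≈⟨ recurrence-shifted n₁≤n L≤t ⟩
      ΣF R terms (λ i → c (residue t) i * evalComp x (recurrenceTerm t i) n)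
        ≈⟨ combinationRow-⋅ x n (c (residue t)) (recurrenceTerm t) (∈-comps-recurrence L≤t t<end) ⟨
      combinationRow (c (residue t)) (recurrenceTerm t) ⋅ values x n ∎
      where
      t = + (q ℕ.^ j ℕ.* toℕ r) ℤ.+ β
      m≤1+j : m ℕ.≤ suc j
      m≤1+j = ℕ.≮⇒≥ (λ 1+j<m → ℕ.<⇒≢ (ℕ.^-monoʳ-< q 2≤q (ℕ.<-trans 1+j<m m<M)) qʲ⁺¹≡qᴹ)
      top = Equivalence.to (InBlock-≥m m≤1+j) t∈
      L≤t = proj₁ top
      t<end : t ℤ.< P ℤ.+ (U ℤ.- (G ℤ.- ℤ.1ℤ))
      t<end = ≡.subst (λ α → t ℤ.< + α ℤ.+ (U ℤ.- (G ℤ.- ℤ.1ℤ))) qʲ⁺¹≡qᴹ (proj₂ top)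

    row-⋅ : ∀ {j β n} (r : Fin q) → j ℕ.< M → InBlock j β → n₁ q M m ℓ n₀ ℤ.≤ + n →
      evalComp x (q ℕ.^ j , β) (q ℕ.* n ℕ.+ toℕ r) ≈ row c r (q ℕ.^ j , β) ⋅ values x n
    row-⋅ {j} {β} {n} r j<M β∈ n₁≤n = trans
      (reflexive (evalComp-digit x q (q ℕ.^ j) β n (toℕ r)))
      (row-⋅-next r j<M (InBlock-step (Fin.toℕ<n r) β∈) n₁≤n)

    representation : ∀ (r : Fin q) (n : ℕ) → n₁ q M m ℓ n₀ ℤ.≤ + n →
      _≋_ R (vseq R q M m ℓ u x (q ℕ.* n ℕ.+ toℕ r)) (_·_ R (matrices c r) (vseq R q M m ℓ u x n))
    representation r n n₁≤n i with ∈-comps⁻ (∈-lookup i)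
    ... | j , β , j<M , κ≡ , β∈ =
      ≡.subst (λ κ → evalComp x κ (q ℕ.* n ℕ.+ toℕ r) ≈ row c r κ ⋅ values x n) (≡.sym κ≡)
        (row-⋅ r j<M β∈ n₁≤n)

open import Data.Nat using (_≤_; _<_)

theorem3p6 : {a b : Level} (R : CommutativeRing a b) →
    let open CommutativeRing R in
    (q M m : ℕ) → 2 ≤ q → m < M →
    (ℓ u : ℤ) → ℓ ℤ.≤ u →
    -- the matrices depend only on q, M, m, ℓ, u and the coefficients c
    Σ ((Fin (q ℕ.^ M) → Fin (ℕ.suc ℤ.∣ u ℤ.- ℓ ∣) → Carrier) →
       Fin q → Matrix R (dim q M m ℓ u)) λ A →
    (c : Fin (q ℕ.^ M) → Fin (ℕ.suc ℤ.∣ u ℤ.- ℓ ∣) → Carrier) →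
    (n₀ : ℕ) → 0ℤ ℤ.≤ + (q ℕ.^ m ℕ.* n₀) ℤ.+ ℓ →
    (x : ℕ → Carrier) →
    (∀ (n : ℕ) → n₀ ≤ n → (s : Fin (q ℕ.^ M)) →
       x (q ℕ.^ M ℕ.* n ℕ.+ toℕ s) ≈
       ΣF R _ (λ i → c s i * ext R x (+ (q ℕ.^ m ℕ.* n) ℤ.+ (ℓ ℤ.+ + toℕ i)))) →
    -- x is a component of v
    (Σ (Fin (dim q M m ℓ u)) λ i → ∀ n → vseq R q M m ℓ u x n i ≈ x n) ×
    -- v(qn+r) = A_r v(n) for n ≥ n₁
    (∀ (r : Fin q) (n : ℕ) → n₁ q M m ℓ n₀ ℤ.≤ + n →
       _≋_ R (vseq R q M m ℓ u x (q ℕ.* n ℕ.+ toℕ r)) (_·_ R (A c r) (vseq R q M m ℓ u x n))) ×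
    -- in particular x is q-regular with offset n₁
    IsRegularWithOffset R q (n₁ q M m ℓ n₀) x
theorem3p6 R q M m 2≤q m<M ℓ u ℓ≤u = matrices , λ c n₀ _ x hx →
  let open Correctness c n₀ x hx in
  x-component x , representation ,
  isRegular-fromComponent (vseq R q M m ℓ u x) (matrices c) (proj₁ (x-component x)) (proj₂ (x-component x)) representation
  where
  open Construction R q M m 2≤q m<M ℓ u ℓ≤u
  open LinearAlgebra R
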